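{- Let $P$ be a finite set of propositional letters and let $\dagger:\mathbb{G}(P)\times\mathcal{L}_0(P)\to\mathbb{G}(P)$ be a P-graph transformation. The following are equivalent: (1) $\dagger$ is relevant; (2) for all P-graphs $G_1,G_2$ and every propositional formula $\varphi$, if $G_1\equiv_\psi G_2$ for some propositional formula $\psi$, then $\dagger(G_1,\varphi)\equiv_\psi\dagger(G_2,\varphi)$.
   Context: $\mathcal{L}_0(P)$ is the classical propositional language over $P$. A preference model is a tuple $M=\langle W,\leq,v\rangle$ with $W\subseteq 2^P$ (worlds are propositional valuations), $\leq$ a reflexive and transitive relation on $W$, and $v(p)=\{w\in W: p\in w\}$. A P-graph is $G=\langle\Phi,\prec\rangle$ with $\Phi\subset\mathcal{L}_0(P)$ finite and $\prec$ a strict partial order on $\Phi$; $\mathbb{G}(P)$ is the set of all P-graphs over $P$. $M$ is induced by $G$ iff for all $w,w'\in W$: $w\leq w'$ iff for every $\varphi\in\Phi$, either ($w'\vDash\varphi\Rightarrow w\vDash\varphi$) or there is $\psi\in\Phi$ with $\psi\prec\varphi$, $w\vDash\psi$, $w'\not\vDash\psi$. A dynamic operator $\star$ maps each preference model $M=\langle W,\leq,v\rangle$ and $\varphi\in\mathcal{L}_0(P)$ to a preference model $\star(M,\varphi)=\langle W,\leq_\star,v\rangle$ (only the relation may change). A P-graph transformation is any function $\dagger:\mathbb{G}(P)\times\mathcal{L}_0(P)\to\mathbb{G}(P)$. A dynamic operator $\star$ is induced by $\dagger$ if for every preference model $M$, every P-graph $G$ and every $\varphi\in\mathcal{L}_0(P)$: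 if $M$ is induced by $G$ then $\star(M,\varphi)$ is induced by $\dagger(G,\varphi)$. $\dagger$ is relevant if some dynamic operator is induced by it. For a propositional formula $\psi$, two P-graphs $G_1,G_2$ are $\psi$-equivalent, $G_1\equiv_\psi G_2$, iff for every preference model $M$ such that every world of $M$ satisfies $\psi$, $G_1$ induces $M$ iff $G_2$ induces $M$. -}

module Defs where

open import Level using (0ℓ)
open import Data.Nat using (ℕ)
open import Data.Fin using (Fin)
open import Data.Bool using (Bool; true; false; not; _∧_; _∨_; T)
open import Data.Product using (Σ; ∃; _×_; _,_)
open import Data.Sum using (_⊎_)
open import Relation.Nullary using (¬_)
open import Function.Definitions using (Injective)
open import Relation.Binary.PropositionalEquality using (_≡_)
open import Function.Bundles using (_⇔_)

-- The set of propositional letters P is Fin n (an arbitrary finite set).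

data Formula (n : ℕ) : Set where
  var  : Fin n → Formula n
  ⊥'   : Formula n
  ⊤'   : Formula n
  ¬'_  : Formula n → Formula n
  _∧'_ : Formula n → Formula n → Formula n
  _∨'_ : Formula n → Formula n → Formula n
  _⇒'_ : Formula n → Formula n → Formula n

Valuation : ℕ → Set
Valuation n = Fin n → Bool

eval : ∀ {n} → Valuation n → Formula n → Bool
eval w (var p)   = w p
eval w ⊥'        = false
eval w ⊤'        = true
eval w (¬' φ)    = not (eval w φ)
eval w (φ ∧' ψ)  = eval w φ ∧ eval w ψ
eval w (φ ∨' ψ)  = eval w φ ∨ eval w ψ
eval w (φ ⇒' ψ)  = not (eval w φ) ∨ eval w ψ

_⊨_ : ∀ {n} → Valuation n → Formula n → Set
w ⊨ φ = T (eval w φ)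

-- A set of worlds W ⊆ 2^P, given by its characteristic function.
WorldSet : ℕ → Set
WorldSet n = Valuation n → Bool

World : ∀ {n} → WorldSet n → Set
World {n} W = Σ (Valuation n) (λ w → T (W w))

-- Preference model ⟨W, ≤, v⟩; v is determined by W (v(p) = {w | p ∈ w}),
-- so a model over W is just a reflexive, transitive relation on W.
record PrefModel {n : ℕ} (W : WorldSet n) : Set₁ where
  field
    _≤_    : World W → World W → Set
    ≤-refl  : ∀ w → w ≤ w
    ≤-trans : ∀ {u w w'} → u ≤ w → w ≤ w' → u ≤ w'

-- P-graph ⟨Φ, ≺⟩: Φ a finite set of formulas (enumerated without repetition
-- by node : Fin size → Formula), ≺ a strict partial order on Φ.
record PGraph (n : ℕ) : Set where
  field
    size     : ℕ
    node     : Fin size → Formula n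
    node-inj : Injective _≡_ _≡_ node
    _≺_      : Fin size → Fin size → Bool
    ≺-irrefl : ∀ i → ¬ T (i ≺ i)
    ≺-trans  : ∀ {i j k} → T (i ≺ j) → T (j ≺ k) → T (i ≺ k)

InducedRel : ∀ {n} → PGraph n → Valuation n → Valuation n → Set
InducedRel G w w' =
  ∀ (i : Fin size) →
    ((w' ⊨ node i → w ⊨ node i)
     ⊎ ∃ λ (j : Fin size) → T (j ≺ i) × w ⊨ node j × ¬ (w' ⊨ node j))
  where open PGraph G

InducedBy : ∀ {n} {W : WorldSet n} → PrefModel W → PGraph n → Set
InducedBy {W = W} M G =
  ∀ (w w' : World W) →
    (w ≤ w') ⇔ InducedRel G (Data.Product.proj₁ w) (Data.Product.proj₁ w')
  where open PrefModel M

DynOp : ℕ → Set₁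
DynOp n = ∀ {W : WorldSet n} → PrefModel W → Formula n → PrefModel W

PGraphTrans : ℕ → Set
PGraphTrans n = PGraph n → Formula n → PGraph n

DynOpInducedBy : ∀ {n} → DynOp n → PGraphTrans n → Set₁
DynOpInducedBy {n} ⋆ † =
  ∀ (W : WorldSet n) (M : PrefModel W) (G : PGraph n) (φ : Formula n) →
    InducedBy M G → InducedBy (⋆ M φ) († G φ)

Relevant : ∀ {n} → PGraphTrans n → Set₁
Relevant {n} † = Σ (DynOp n) (λ ⋆ → DynOpInducedBy ⋆ †)

_≡[_]_ : ∀ {n} → PGraph n → Formula n → PGraph n → Set₁
_≡[_]_ {n} G₁ ψ G₂ =
  ∀ (W : WorldSet n) (M : PrefModel W) →
    (∀ (w : World W) → Data.Product.proj₁ w ⊨ ψ) →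
    InducedBy M G₁ ⇔ InducedBy M G₂

-- The relation a P-graph induces on valuations is always a preorder
-- (transitivity descends along ≺, which is well-founded on a finite set), so
-- every P-graph induces a model on every set of worlds.  Hence G₁ ≡[ ψ ] G₂
-- says exactly that the relations induced by G₁ and G₂ agree on valuations
-- satisfying ψ, and a relevant † carries this agreement to † G₁ φ and † G₂ φ
-- through the model G₁ induces on the ψ-worlds.  Conversely, two P-graphs
-- inducing the same model M are ψ-equivalent when ψ is the disjunction of the
-- characteristic formulas of two worlds a, b of M; if † preserves
-- ψ-equivalence, all † G φ with G inducing M therefore agree on (a , b), and
-- that common relation is the updated model.
module Submission where

open import Defs
open import Data.Nat using (ℕ)
open import Data.Fin using (Fin)
open import Data.Bool using (true; false; not; _∧_; _∨_; T; if_then_else_)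
open import Data.Bool.Properties using (T-≡; T-not-≡; T-∧; T-∨)
open import Data.Unit using (tt)
open import Data.Product using (∃; _×_; _,_; proj₁; proj₂)
open import Data.Sum using (_⊎_; inj₁; inj₂)
open import Data.Empty using (⊥-elim)
open import Data.List using (List; []; _∷_; allFin)
open import Data.List.Relation.Unary.All as All using (All; []; _∷_)
open import Data.List.Membership.Propositional.Properties using (∈-allFin)
open import Data.Fin.Induction using (spo-wellFounded)
open import Function.Base using (id; const; _∘_)
open import Function.Bundles using (_⇔_; mk⇔; Equivalence)
open import Function.Construct.Composition using (_⇔-∘_)
open import Function.Construct.Symmetry using (⇔-sym)
open import Induction.WellFounded using (WellFounded; Acc; acc)
open import Relation.Binary.PropositionalEquality
  using (_≡_; _≗_; refl; sym; cong; cong₂; subst; resp₂; isEquivalence)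
open import Relation.Nullary using (¬_; yes; no)
open import Relation.Nullary.Decidable using (T?)
open Equivalence

private
  variable
    n : ℕ

eval-cong : {u v : Valuation n} → u ≗ v → ∀ φ → eval u φ ≡ eval v φ
eval-cong e (var p)  = e p
eval-cong e ⊥'       = refl
eval-cong e ⊤'       = refl
eval-cong e (¬' φ)   = cong not (eval-cong e φ)
eval-cong e (φ ∧' ψ) = cong₂ _∧_ (eval-cong e φ) (eval-cong e ψ)
eval-cong e (φ ∨' ψ) = cong₂ _∨_ (eval-cong e φ) (eval-cong e ψ)
eval-cong e (φ ⇒' ψ) = cong₂ (λ a b → not a ∨ b) (eval-cong e φ) (eval-cong e ψ)

⊨-resp-≗ : {u v : Valuation n} → u ≗ v → ∀ φ → u ⊨ φ → v ⊨ φ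
⊨-resp-≗ e φ = subst T (eval-cong e φ)

models : Formula n → WorldSet n
models ψ v = eval v ψ

literal : Valuation n → Fin n → Formula n
literal v i = if v i then var i else ¬' var i

characteristicOn : Valuation n → List (Fin n) → Formula n
characteristicOn v []       = ⊤'
characteristicOn v (i ∷ is) = literal v i ∧' characteristicOn v is

characteristic : Valuation n → Formula n
characteristic {n} v = characteristicOn v (allFin n)

⊨-literal : (u v : Valuation n) (i : Fin n) → u ⊨ literal v i ⇔ u i ≡ v i
⊨-literal u v i with v i
... | true  = T-≡
... | false = T-not-≡

⊨-characteristicOn : (u v : Valuation n) (is : List (Fin n)) →
                     u ⊨ characteristicOn v is ⇔ All (λ i → u i ≡ v i) is
⊨-characteristicOn u v []       = mk⇔ (const []) (const tt)
⊨-characteristicOn u v (i ∷ is) = mk⇔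
  (λ t → let (tᵢ , tᵢₛ) = to T-∧ t
         in to (⊨-literal u v i) tᵢ ∷ to (⊨-characteristicOn u v is) tᵢₛ)
  (λ { (eᵢ ∷ eᵢₛ) → from T-∧ (from (⊨-literal u v i) eᵢ
                             , from (⊨-characteristicOn u v is) eᵢₛ) })

⊨-characteristic : (u v : Valuation n) → u ⊨ characteristic v ⇔ u ≗ v
⊨-characteristic {n} u v = mk⇔
  (λ t i → All.lookup (to (⊨-characteristicOn u v (allFin n)) t) (∈-allFin i))
  (λ e → from (⊨-characteristicOn u v (allFin n)) (All.tabulate (λ {i} _ → e i)))

characteristic-self : (v : Valuation n) → v ⊨ characteristic v
characteristic-self v = from (⊨-characteristic v v) (λ _ → refl)

module InducedPreorder (G : PGraph n) where
  open PGraph G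

  _⊏_ : Fin size → Fin size → Set
  i ⊏ j = T (i ≺ j)

  ⊏-wellFounded : WellFounded _⊏_
  ⊏-wellFounded = spo-wellFounded record
    { isEquivalence = isEquivalence
    ; irrefl        = λ { refl → ≺-irrefl _ }
    ; trans         = ≺-trans
    ; <-resp-≈      = resp₂ _⊏_
    }

  Separates : Valuation n → Valuation n → Fin size → Set
  Separates x y k = x ⊨ node k × ¬ (y ⊨ node k)

  inducedRel-refl : (w : Valuation n) → InducedRel G w w
  inducedRel-refl w i = inj₁ id

  -- A node separating w from w' or u from w either witnesses u ≤ w' itself
  -- or lies above a strictly smaller separating node; ⊏ is well-founded, so
  -- the descent stops.
  separation-descends : {u w w' : Valuation n} →
    InducedRel G u w → InducedRel G w w' →
    ∀ k → Acc _⊏_ k → Separates w w' k ⊎ Separates u w k →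
    ∀ {i} → k ⊏ i → ∃ λ j → j ⊏ i × Separates u w' j
  separation-descends {u} u≤w w≤w' k (acc below) (inj₁ (wₖ , ¬w'ₖ)) k⊏i
    with T? (eval u (node k))
  ... | yes uₖ = k , k⊏i , uₖ , ¬w'ₖ
  ... | no ¬uₖ with u≤w k
  ...   | inj₁ f               = ⊥-elim (¬uₖ (f wₖ))
  ...   | inj₂ (k' , k'⊏k , s) =
          separation-descends u≤w w≤w' k' (below k'⊏k) (inj₂ s) (≺-trans k'⊏k k⊏i)
  separation-descends {w' = w'} u≤w w≤w' k (acc below) (inj₂ (uₖ , ¬wₖ)) k⊏i
    with T? (eval w' (node k))
  ... | no ¬w'ₖ = k , k⊏i , uₖ , ¬w'ₖ
  ... | yes w'ₖ with w≤w' k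
  ...   | inj₁ g               = ⊥-elim (¬wₖ (g w'ₖ))
  ...   | inj₂ (k' , k'⊏k , s) =
          separation-descends u≤w w≤w' k' (below k'⊏k) (inj₁ s) (≺-trans k'⊏k k⊏i)

  inducedRel-trans : {u w w' : Valuation n} →
                     InducedRel G u w → InducedRel G w w' → InducedRel G u w'
  inducedRel-trans u≤w w≤w' i with u≤w i | w≤w' i
  ... | inj₁ f | inj₁ g = inj₁ (f ∘ g)
  ... | inj₂ (k , k⊏i , s) | _ =
        inj₂ (separation-descends u≤w w≤w' k (⊏-wellFounded k) (inj₂ s) k⊏i)
  ... | inj₁ _ | inj₂ (k , k⊏i , s) =
        inj₂ (separation-descends u≤w w≤w' k (⊏-wellFounded k) (inj₁ s) k⊏i)

  inducedRel-resp-≗ : {u u' v v' : Valuation n} → u ≗ u' → v ≗ v' →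
                      InducedRel G u v → InducedRel G u' v'
  inducedRel-resp-≗ u≗u' v≗v' u≤v i with u≤v i
  ... | inj₁ f = inj₁ (⊨-resp-≗ u≗u' (node i) ∘ f ∘ ⊨-resp-≗ (sym ∘ v≗v') (node i))
  ... | inj₂ (j , j⊏i , uⱼ , ¬vⱼ) =
        inj₂ (j , j⊏i , ⊨-resp-≗ u≗u' (node j) uⱼ , ¬vⱼ ∘ ⊨-resp-≗ (sym ∘ v≗v') (node j))

  inducedRel-cong : {u u' v v' : Valuation n} → u ≗ u' → v ≗ v' →
                    InducedRel G u v ⇔ InducedRel G u' v'
  inducedRel-cong u≗u' v≗v' = mk⇔ (inducedRel-resp-≗ u≗u' v≗v')
                                   (inducedRel-resp-≗ (sym ∘ u≗u') (sym ∘ v≗v'))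

open InducedPreorder public
  using (inducedRel-refl; inducedRel-trans; inducedRel-cong)

inducedModel : (G : PGraph n) (W : WorldSet n) → PrefModel W
inducedModel G W = record
  { _≤_     = λ a b → InducedRel G (proj₁ a) (proj₁ b)
  ; ≤-refl  = λ a → inducedRel-refl G (proj₁ a)
  ; ≤-trans = inducedRel-trans G
  }

inducedModel-inducedBy : (G : PGraph n) (W : WorldSet n) →
                         InducedBy (inducedModel G W) G
inducedModel-inducedBy G W a b = mk⇔ id id

inducedBy-agree : {W : WorldSet n} (M : PrefModel W) (G₁ G₂ : PGraph n) →
                  InducedBy M G₁ → InducedBy M G₂ → (a b : World W) →
                  InducedRel G₁ (proj₁ a) (proj₁ b) ⇔ InducedRel G₂ (proj₁ a) (proj₁ b)
inducedBy-agree M G₁ G₂ M-G₁ M-G₂ a b = M-G₂ a b ⇔-∘ ⇔-sym (M-G₁ a b)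

AgreeOn : Formula n → PGraph n → PGraph n → Set
AgreeOn ψ G₁ G₂ = ∀ x y → x ⊨ ψ → y ⊨ ψ → InducedRel G₁ x y ⇔ InducedRel G₂ x y

≡[]⇒agreeOn : (G₁ G₂ : PGraph n) (ψ : Formula n) → G₁ ≡[ ψ ] G₂ → AgreeOn ψ G₁ G₂
≡[]⇒agreeOn G₁ G₂ ψ G₁≡G₂ x y x⊨ψ y⊨ψ =
  inducedBy-agree M G₁ G₂ M-G₁ M-G₂ (x , x⊨ψ) (y , y⊨ψ)
  where
  M : PrefModel (models ψ)
  M = inducedModel G₁ (models ψ)
  M-G₁ : InducedBy M G₁
  M-G₁ = inducedModel-inducedBy G₁ (models ψ)
  M-G₂ : InducedBy M G₂
  M-G₂ = to (G₁≡G₂ (models ψ) M proj₂) M-G₁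

agreeOn⇒≡[] : (G₁ G₂ : PGraph n) (ψ : Formula n) → AgreeOn ψ G₁ G₂ → G₁ ≡[ ψ ] G₂
agreeOn⇒≡[] G₁ G₂ ψ agree W M W⊨ψ = mk⇔
  (λ M-G₁ a b → agree _ _ (W⊨ψ a) (W⊨ψ b) ⇔-∘ M-G₁ a b)
  (λ M-G₂ a b → ⇔-sym (agree _ _ (W⊨ψ a) (W⊨ψ b)) ⇔-∘ M-G₂ a b)

characteristic-cover : (u v x : Valuation n) →
                       x ⊨ (characteristic u ∨' characteristic v) → x ≗ u ⊎ x ≗ v
characteristic-cover u v x t with to T-∨ t
... | inj₁ x⊨u = inj₁ (to (⊨-characteristic x u) x⊨u)
... | inj₂ x⊨v = inj₂ (to (⊨-characteristic x v) x⊨v)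

inducedBy⇒≡[] : {W : WorldSet n} (M : PrefModel W) (G₁ G₂ : PGraph n) (ψ : Formula n) →
                (∀ x → x ⊨ ψ → ∃ λ (c : World W) → x ≗ proj₁ c) →
                InducedBy M G₁ → InducedBy M G₂ → G₁ ≡[ ψ ] G₂
inducedBy⇒≡[] M G₁ G₂ ψ cover M-G₁ M-G₂ = agreeOn⇒≡[] G₁ G₂ ψ λ x y x⊨ψ y⊨ψ →
  let (c , x≗c) = cover x x⊨ψ
      (d , y≗d) = cover y y⊨ψ
  in inducedRel-cong G₂ (sym ∘ x≗c) (sym ∘ y≗d)
     ⇔-∘ (inducedBy-agree M G₁ G₂ M-G₁ M-G₂ c d
     ⇔-∘ inducedRel-cong G₁ x≗c y≗d)

PreservesEquivalence : PGraphTrans n → Set₁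
PreservesEquivalence {n} † = ∀ (G₁ G₂ : PGraph n) (φ ψ : Formula n) →
                             G₁ ≡[ ψ ] G₂ → † G₁ φ ≡[ ψ ] † G₂ φ

relevant⇒preservesEquivalence : († : PGraphTrans n) → Relevant † → PreservesEquivalence †
relevant⇒preservesEquivalence † (⋆ , ⋆-induced) G₁ G₂ φ ψ G₁≡G₂ =
  agreeOn⇒≡[] († G₁ φ) († G₂ φ) ψ λ x y x⊨ψ y⊨ψ →
    inducedBy-agree (⋆ M φ) († G₁ φ) († G₂ φ)
      (⋆-induced (models ψ) M G₁ φ M-G₁) (⋆-induced (models ψ) M G₂ φ M-G₂)
      (x , x⊨ψ) (y , y⊨ψ)
  where
  M : PrefModel (models ψ)
  M = inducedModel G₁ (models ψ)
  M-G₁ : InducedBy M G₁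
  M-G₁ = inducedModel-inducedBy G₁ (models ψ)
  M-G₂ : InducedBy M G₂
  M-G₂ = to (G₁≡G₂ (models ψ) M proj₂) M-G₁

intersectionOperator : PGraphTrans n → DynOp n
intersectionOperator † M φ = record
  { _≤_     = λ a b → ∀ G → InducedBy M G → InducedRel († G φ) (proj₁ a) (proj₁ b)
  ; ≤-refl  = λ a G _ → inducedRel-refl († G φ) (proj₁ a)
  ; ≤-trans = λ a≤b b≤c G M-G → inducedRel-trans († G φ) (a≤b G M-G) (b≤c G M-G)
  }

preservesEquivalence⇒inducedBy-agree :
  († : PGraphTrans n) → PreservesEquivalence † →
  {W : WorldSet n} (M : PrefModel W) (G G' : PGraph n) (φ : Formula n) →
  InducedBy M G → InducedBy M G' → (a b : World W) →
  InducedRel († G φ) (proj₁ a) (proj₁ b) ⇔ InducedRel († G' φ) (proj₁ a) (proj₁ b)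
preservesEquivalence⇒inducedBy-agree † preserves {W} M G G' φ M-G M-G' (u , u∈W) (v , v∈W) =
  ≡[]⇒agreeOn († G φ) († G' φ) ψ (preserves G G' φ ψ G≡G') u v
    (from T-∨ (inj₁ (characteristic-self u))) (from T-∨ (inj₂ (characteristic-self v)))
  where
  ψ : Formula _
  ψ = characteristic u ∨' characteristic v
  cover : ∀ x → x ⊨ ψ → ∃ λ (c : World W) → x ≗ proj₁ c
  cover x x⊨ψ with characteristic-cover u v x x⊨ψ
  ... | inj₁ x≗u = (u , u∈W) , x≗u
  ... | inj₂ x≗v = (v , v∈W) , x≗v
  G≡G' : G ≡[ ψ ] G'
  G≡G' = inducedBy⇒≡[] M G G' ψ cover M-G M-G'

preservesEquivalence⇒relevant : († : PGraphTrans n) → PreservesEquivalence † → Relevant †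
preservesEquivalence⇒relevant † preserves =
  intersectionOperator † , λ W M G φ M-G a b → mk⇔
    (λ a≤b → a≤b G M-G)
    (λ a≤b G' M-G' →
       to (preservesEquivalence⇒inducedBy-agree † preserves M G G' φ M-G M-G' a b) a≤b)

proposition1 : (n : ℕ) († : PGraphTrans n) →
    Relevant † ⇔
      (∀ (G₁ G₂ : PGraph n) (φ ψ : Formula n) →
        G₁ ≡[ ψ ] G₂ → † G₁ φ ≡[ ψ ] † G₂ φ)
proposition1 n † = mk⇔ (relevant⇒preservesEquivalence †) (preservesEquivalence⇒relevant †)
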